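{- Let $P$ be the infinite matrix indexed by the non-negative integers with $P(r+1,r)=1$, $P(r,r)=r-1$, $P(r,r+1)=-r-1$ for $r\geq0$, and $P(r,s)=0$ for $|r-s|>1$. Then for each $r\geq 0$, $i\geq 1$ and $j\geq 1$, \[\nu_2\bigl(P^j(r,r+i)\bigr)\geq \nu_2(i!).\]
   Context: $\nu_2(a)$ is the exponent of the largest power of $2$ dividing the integer $a$, with $\nu_2(0)=\infty$. -}

module Defs where

open import Data.Nat using (ℕ; zero; suc; _^_; _≟_)
import Data.Nat
open import Data.Integer using (ℤ; +_; _+_; _*_; -_; _-_)
open import Data.Integer.Divisibility using (_∣_)
open import Relation.Nullary using (yes; no)

P : ℕ → ℕ → ℤ
P r s with suc s ≟ r | r ≟ s | suc r ≟ s
... | yes _ | _     | _     = + 1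
... | no _  | yes _ | _     = + r - + 1
... | no _  | no _  | yes _ = - (+ r) - + 1
... | no _  | no _  | no _  = + 0

-- P^0 = identity and
--   P^(j+1)(r, s) = Σ_k P(r, k) · P^j(k, s).
-- Since row r of P is supported on k ∈ {r-1, r, r+1}, this sum is finite
-- and is written out exactly (the k = r-1 term only when r ≥ 1).
Ppow : ℕ → ℕ → ℕ → ℤ
Ppow zero r s with r ≟ s
... | yes _ = + 1
... | no _  = + 0
Ppow (suc j) zero s = P zero zero * Ppow j zero s + P zero 1 * Ppow j 1 s
Ppow (suc j) (suc r) s =
  P (suc r) r * Ppow j r s + P (suc r) (suc r) * Ppow j (suc r) s
    + P (suc r) (suc (suc r)) * Ppow j (suc (suc r)) s

-- "ν₂(a) ≥ n" for an integer a, with ν₂(0) = ∞: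
-- by definition of the 2-adic valuation this holds iff 2^n divides a.
ν₂≥ : ℤ → ℕ → Set
ν₂≥ a n = + (2 ^ n) ∣ a

-- ν₂ of a positive natural number: the exponent of the largest power of 2
-- dividing it.  Defined with fuel (n itself suffices as fuel for n ≥ 1).
ν₂ℕ-aux : ℕ → ℕ → ℕ
ν₂ℕ-aux zero    _ = 0
ν₂ℕ-aux (suc f) n with n Data.Nat.% 2
... | zero  = suc (ν₂ℕ-aux f (n Data.Nat./ 2))
... | suc _ = 0

-- Meaningful for n ≥ 1 (ν₂ℕ 0 = 0 is a junk value, never used below since i! ≥ 1).
ν₂ℕ : ℕ → ℕ
ν₂ℕ n = ν₂ℕ-aux n n

-- Every entry P^j(r, r+i) is divisible by the rising factorial (r+1)(r+2)⋯(r+i) = (r+i)!/r!,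
-- hence by i!, and so by 2^ν₂(i!).  The divisibility is proved by induction on j from the
-- three-term recurrence for P^(j+1)(r, r+i): the term through P^j(r-1, r+i) carries one more
-- factor than needed, and the term through P^j(r+1, r+i) recovers its missing factor r+1 from
-- P(r, r+1) = -(r+1).
module Submission where

open import Defs
open import Data.Nat using (ℕ; zero; suc; _+_; _≥_; _!; _^_; _≟_)
import Data.Nat as ℕ
import Data.Nat.Properties as ℕ
import Data.Nat.Divisibility as ℕ
open import Data.Nat.DivMod using (m≡m%n+[m/n]*n)
open import Data.Nat.Combinatorics using (k![n∸k]!∣n!)
open import Data.Integer using (+_; -_; _-_)
import Data.Integer as ℤ
import Data.Integer.Properties as ℤ
open import Data.Integer.Divisibility.Signed
  using (_∣_; ∣ᵤ⇒∣; ∣⇒∣ᵤ; ∣-refl; ∣-trans; ∣m∣n⇒∣m+n; ∣m⇒∣-m; ∣n⇒∣m*n; *-monoʳ-∣; *-monoˡ-∣)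
open import Relation.Binary.PropositionalEquality
open import Relation.Nullary using (yes; no; ¬_)
open import Data.Empty using (⊥-elim)

2^ν₂ℕ-aux∣ : ∀ fuel n → 2 ^ ν₂ℕ-aux fuel n ℕ.∣ n
2^ν₂ℕ-aux∣ zero       n = ℕ.1∣ n
2^ν₂ℕ-aux∣ (suc fuel) n with n ℕ.% 2 in n%2≡0
... | suc _ = ℕ.1∣ n
... | zero  = subst (2 ℕ.* 2 ^ ν₂ℕ-aux fuel (n ℕ./ 2) ℕ.∣_) (sym n≡2*[n/2])
                (ℕ.*-monoʳ-∣ 2 (2^ν₂ℕ-aux∣ fuel (n ℕ./ 2)))
  where
  n≡2*[n/2] : n ≡ 2 ℕ.* (n ℕ./ 2)
  n≡2*[n/2] = begin
    n                           ≡⟨ m≡m%n+[m/n]*n n 2 ⟩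
    n ℕ.% 2 + n ℕ./ 2 ℕ.* 2     ≡⟨ cong (_+ n ℕ./ 2 ℕ.* 2) n%2≡0 ⟩
    n ℕ./ 2 ℕ.* 2               ≡⟨ ℕ.*-comm (n ℕ./ 2) 2 ⟩
    2 ℕ.* (n ℕ./ 2)             ∎
    where open ≡-Reasoning

2^ν₂ℕ∣ : ∀ n → 2 ^ ν₂ℕ n ℕ.∣ n
2^ν₂ℕ∣ n = 2^ν₂ℕ-aux∣ n n

rising : ℕ → ℕ → ℕ
rising x zero    = 1
rising x (suc k) = x ℕ.* rising (suc x) k

rising-suc*!≡! : ∀ n k → rising (suc n) k ℕ.* n ! ≡ (n + k) !
rising-suc*!≡! n zero = trans (ℕ.+-identityʳ (n !)) (cong _! (sym (ℕ.+-identityʳ n)))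
rising-suc*!≡! n (suc k) = begin
  suc n ℕ.* rising (suc (suc n)) k ℕ.* n !   ≡⟨ cong (ℕ._* n !) (ℕ.*-comm (suc n) (rising (suc (suc n)) k)) ⟩
  rising (suc (suc n)) k ℕ.* suc n ℕ.* n !   ≡⟨ ℕ.*-assoc (rising (suc (suc n)) k) (suc n) (n !) ⟩
  rising (suc (suc n)) k ℕ.* suc n !         ≡⟨ rising-suc*!≡! (suc n) k ⟩
  (suc n + k) !                              ≡⟨ cong _! (sym (ℕ.+-suc n k)) ⟩
  (n + suc k) !                              ∎
  where open ≡-Reasoning

k!∣rising-suc : ∀ n k → k ! ℕ.∣ rising (suc n) k
k!∣rising-suc n k = ℕ.*-cancelʳ-∣ (n !) {{ℕ._!≢0 n}}
  (subst₂ ℕ._∣_ (cong (λ m → k ! ℕ.* m !) (ℕ.m+n∸n≡m n k)) (sym (rising-suc*!≡! n k))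
    (k![n∸k]!∣n! (ℕ.m≤n+m k n)))

*-pres-∣ : ∀ {a b x y} → a ∣ x → b ∣ y → a ℤ.* b ∣ x ℤ.* y
*-pres-∣ {b = b} {x = x} a∣x b∣y = ∣-trans (*-monoˡ-∣ b a∣x) (*-monoʳ-∣ x b∣y)

+rising-suc : ∀ x k → + rising x (suc k) ≡ + x ℤ.* + rising (suc x) k
+rising-suc x k = ℤ.pos-* x (rising (suc x) k)

Ppow-zero-offDiagonal : ∀ r s → ¬ r ≡ s → Ppow 0 r s ≡ + 0
Ppow-zero-offDiagonal r s r≢s with r ≟ s
... | yes r≡s = ⊥-elim (r≢s r≡s)
... | no _    = refl

P-superdiagonal : ∀ r → P r (suc r) ≡ - (+ suc r)
P-superdiagonal r with suc (suc r) ≟ r | r ≟ suc r | suc r ≟ suc r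
... | yes e | _     | _     = ⊥-elim (ℕ.m+1+n≢m r {1} (trans (ℕ.+-comm r 2) e))
... | no _  | yes e | _     = ⊥-elim (ℕ.1+n≢n (sym e))
... | no _  | no _  | no ne = ⊥-elim (ne refl)
... | no _  | no _  | yes _ = begin
  - (+ r) - + 1     ≡⟨ ℤ.neg-distrib-+ (+ r) (+ 1) ⟨
  - (+ (r + 1))     ≡⟨ cong (λ n → - (+ n)) (ℕ.+-comm r 1) ⟩
  - (+ suc r)       ∎
  where open ≡-Reasoning

RisingDivides : ℕ → Set
RisingDivides j = ∀ r i → + rising (suc r) i ∣ Ppow j r (r + i)

RisingDivides-zero : RisingDivides 0
RisingDivides-zero r zero    = ∣ᵤ⇒∣ (ℕ.1∣ _)
RisingDivides-zero r (suc i) rewrite Ppow-zero-offDiagonal r (r + suc i) (λ e → ℕ.m+1+n≢m r {i} (sym e)) =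
  ∣ᵤ⇒∣ (ℕ._∣0 _)

module _ {j} (ih : RisingDivides j) where

  below-divisible : ∀ r i → + rising (suc (suc r)) i ∣ P (suc r) r ℤ.* Ppow j r (suc r + i)
  below-divisible r i = ∣n⇒∣m*n (P (suc r) r) (∣-trans rising∣rising ih-shifted)
    where
    rising∣rising : + rising (suc (suc r)) i ∣ + rising (suc r) (suc i)
    rising∣rising = subst (+ rising (suc (suc r)) i ∣_) (sym (+rising-suc (suc r) i)) (∣n⇒∣m*n (+ suc r) ∣-refl)
    ih-shifted : + rising (suc r) (suc i) ∣ Ppow j r (suc r + i)
    ih-shifted = subst (λ s → + rising (suc r) (suc i) ∣ Ppow j r s) (ℕ.+-suc r i) (ih r (suc i))

  diagonal-divisible : ∀ r i → + rising (suc r) i ∣ P r r ℤ.* Ppow j r (r + i)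
  diagonal-divisible r i = ∣n⇒∣m*n (P r r) (ih r i)

  above-divisible : ∀ r i → + rising (suc r) i ∣ P r (suc r) ℤ.* Ppow j (suc r) (r + i)
  above-divisible r zero    = ∣ᵤ⇒∣ (ℕ.1∣ _)
  above-divisible r (suc i) rewrite +rising-suc (suc r) i | ℕ.+-suc r i =
    *-pres-∣ (subst (+ suc r ∣_) (sym (P-superdiagonal r)) (∣m⇒∣-m ∣-refl)) (ih (suc r) i)

  RisingDivides-suc : RisingDivides (suc j)
  RisingDivides-suc zero    i = ∣m∣n⇒∣m+n (diagonal-divisible 0 i) (above-divisible 0 i)
  RisingDivides-suc (suc r) i =
    ∣m∣n⇒∣m+n (∣m∣n⇒∣m+n (below-divisible r i) (diagonal-divisible (suc r) i))
      (above-divisible (suc r) i)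

rising-suc∣Ppow : ∀ j → RisingDivides j
rising-suc∣Ppow zero    = RisingDivides-zero
rising-suc∣Ppow (suc j) = RisingDivides-suc (rising-suc∣Ppow j)

-- The bound holds for all i and j.
lemma4p1 : (r i j : ℕ) → i ≥ 1 → j ≥ 1 →
    ν₂≥ (Ppow j r (r + i)) (ν₂ℕ (i !))
lemma4p1 r i j _ _ =
  ℕ.∣-trans (2^ν₂ℕ∣ (i !)) (ℕ.∣-trans (k!∣rising-suc r i) (∣⇒∣ᵤ (rising-suc∣Ppow j r i)))
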